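{- If $m\ge 3$ and $n\ge 3$, then $\chi_{\rho}(K_{1,m}, K_{1,n})=3$ and $$\min\{m+2,n+2\}\le \widehat{\chi}_{\rho}(K_{1,m}, K_{1,n})\le \max\{m+2,n+2\}\,.$$
   Context: For graphs $G$ and $H$ and a function $f\colon V(G)\to V(H)$, the Sierpiński product $G\otimes_f H$ is the graph with vertex set $V(G)\times V(H)$ whose edges are: $(g,h)(g,h')$ for every $g\in V(G)$ and every edge $hh'\in E(H)$; and $(g,f(g'))(g',f(g))$ for every edge $gg'\in E(G)$. Let $H^G$ denote the set of all functions $V(G)\to V(H)$. For a graph $X$, a packing $k$-coloring is a map $c\colon V(X)\to\{1,\dots,k\}$ such that whenever $u\neq v$ and $c(u)=c(v)=\ell$, the shortest-path distance satisfies $d_X(u,v)>\ell$; the packing chromatic number $\chi_\rho(X)$ is the least $k$ for which a packing $k$-coloring exists. The Sierpiński packing chromatic number of $(G,H)$ is $\chi_\rho(G,H)=\min_{f\in H^G}\chi_\rho(G\otimes_f H)$ and the upper one is $\widehat{\chi}_\rho(G,H)=\max_{f\in H^G}\chi_\rho(G\otimes_f H)$. $K_{1,m}$ is the star with $m$ leaves. -}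

module Defs where

open import Data.Nat using (ℕ; zero; suc; _≤_; _⊔_; _⊓_)
open import Data.Fin using (Fin; toℕ) renaming (zero to fzero; suc to fsuc)
open import Data.Product using (Σ; _×_; _,_)
open import Data.Sum using (_⊎_)
open import Data.Unit using (⊤)
open import Data.Empty using (⊥)
open import Relation.Nullary using (¬_)
open import Relation.Binary.PropositionalEquality using (_≡_; _≢_)

record Graph : Set₁ where
  field
    V   : Set
    Adj : V → V → Set
open Graph public

StarAdj : {m : ℕ} → Fin (suc m) → Fin (suc m) → Set
StarAdj fzero    fzero    = ⊥
StarAdj fzero    (fsuc _) = ⊤
StarAdj (fsuc _) fzero    = ⊤
StarAdj (fsuc _) (fsuc _) = ⊥

Star : ℕ → Graph
Star m = record { V = Fin (suc m) ; Adj = StarAdj }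

SierpAdj : (G H : Graph) → (V G → V H) → V G × V H → V G × V H → Set
SierpAdj G H f (g , h) (g' , h') =
  (g ≡ g' × Adj H h h') ⊎ (Adj G g g' × (h ≡ f g' × h' ≡ f g))

Sierp : (G H : Graph) → (V G → V H) → Graph
Sierp G H f = record { V = V G × V H ; Adj = SierpAdj G H f }

data Walk (X : Graph) : V X → V X → ℕ → Set where
  here : ∀ {u} → Walk X u u 0
  step : ∀ {u v w k} → Adj X u v → Walk X v w k → Walk X u w (suc k)

-- d_X(u,v) > ℓ  iff there is no walk of length ≤ ℓ from u to v
-- (this also covers d = ∞ for disconnected u, v).
DistGt : (X : Graph) → V X → V X → ℕ → Set
DistGt X u v ℓ = ¬ (Σ ℕ λ k → k ≤ ℓ × Walk X u v k)

-- Packing k-colouring; colour i : Fin k stands for the colour toℕ i + 1 ∈ {1..k}.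
IsPackingColoring : (X : Graph) (k : ℕ) → (V X → Fin k) → Set
IsPackingColoring X k c =
  ∀ u v → u ≢ v → c u ≡ c v → DistGt X u v (suc (toℕ (c u)))

HasPackingColoring : Graph → ℕ → Set
HasPackingColoring X k = Σ (V X → Fin k) (IsPackingColoring X k)

IsPackingChromaticNumber : Graph → ℕ → Set
IsPackingChromaticNumber X k =
  HasPackingColoring X k × (∀ j → HasPackingColoring X j → k ≤ j)

IsSierpinskiPackingChromaticNumber : Graph → Graph → ℕ → Set
IsSierpinskiPackingChromaticNumber G H k =
  (Σ (V G → V H) λ f → IsPackingChromaticNumber (Sierp G H f) k)
  × (∀ f j → IsPackingChromaticNumber (Sierp G H f) j → k ≤ j)

IsUpperSierpinskiPackingChromaticNumber : Graph → Graph → ℕ → Set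
IsUpperSierpinskiPackingChromaticNumber G H k =
  (Σ (V G → V H) λ f → IsPackingChromaticNumber (Sierp G H f) k)
  × (∀ f j → IsPackingChromaticNumber (Sierp G H f) j → j ≤ k)

{-# OPTIONS --safe #-}
-- Every Sierpiński product of two stars contains a path on four vertices (the edge between the
-- copies 0 and 1 extended inside both), so it needs three colours; if f sends the centre to a leaf
-- and the leaves to the centre, three suffice: 1 on all leaves, 2 on the centres of the leaf
-- copies, 3 on the centre of the central copy.
-- For the upper number k = m + 2: every f admits m + 2 colours, as each of the m leaf copies owns
-- one colour ≥ 3 and spends it where colours 1 and 2 would clash.  Conversely, if f is constantly
-- the centre, the product has diameter 4 and its centres are pairwise at distance ≤ 2.  Each copy
-- has a centre of colour ≥ 2 or, its ≥ 3 leaves then carrying distinct colours ≥ 2, a vertex of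
-- colour ≥ 4; these m + 1 vertices carry distinct colours, none of them 1.
module Submission where

open import Defs
open import Data.Nat using (ℕ; _≤_; _⊔_; _⊓_; _+_; zero; suc; z≤n; s≤s)
open import Data.Nat.Properties using (≤-trans; ≤-refl; ≤-reflexive; +-mono-≤; m⊓n≤m; m≤m⊔n; +-comm)
open import Data.Fin using (Fin; toℕ) renaming (zero to fzero; suc to fsuc)
open import Data.Fin.Properties using (¬Fin0; 0≢1+n; suc-injective; injective⇒≤; _≟_)
open import Data.Product using (Σ; _×_; _,_; proj₁; proj₂)
open import Data.Sum using (_⊎_; inj₁; inj₂)
open import Data.Unit using (tt)
open import Data.Empty using (⊥; ⊥-elim)
open import Relation.Nullary using (¬_; yes; no)
open import Function using (_∘_)
open import Function.Definitions using (Injective)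
open import Relation.Binary.PropositionalEquality using (_≡_; _≢_; refl; sym; trans; cong; subst)

WalkWithin : (X : Graph) → V X → V X → ℕ → Set
WalkWithin X u v ℓ = Σ ℕ λ k → k ≤ ℓ × Walk X u v k

module _ {X : Graph} where

  stay : {u : V X} {ℓ : ℕ} → WalkWithin X u u ℓ
  stay = 0 , z≤n , here

  edge : {u v : V X} → Adj X u v → WalkWithin X u v 1
  edge a = 1 , ≤-refl , step a here

  _++ʷ_ : {u v w : V X} {k l : ℕ} → Walk X u v k → Walk X v w l → Walk X u w (k + l)
  here     ++ʷ q = q
  step a p ++ʷ q = step a (p ++ʷ q)

  _⊙_ : {u v w : V X} {k l : ℕ} → WalkWithin X u v k → WalkWithin X v w l → WalkWithin X u w (k + l)
  (_ , k≤ , p) ⊙ (_ , l≤ , q) = _ , +-mono-≤ k≤ l≤ , p ++ʷ q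

  nonAdjacent⇒DistGt1 : {u v : V X} → u ≢ v → ¬ Adj X u v → DistGt X u v 1
  nonAdjacent⇒DistGt1 u≢v _  (zero , _ , here)             = u≢v refl
  nonAdjacent⇒DistGt1 _   ¬a (suc zero , _ , step a here) = ¬a a
  nonAdjacent⇒DistGt1 _   _  (suc (suc _) , s≤s () , _)

  noCommonNeighbour⇒DistGt2 : {u v : V X} → u ≢ v → ¬ Adj X u v →
                              (∀ x → Adj X u x → Adj X x v → ⊥) → DistGt X u v 2
  noCommonNeighbour⇒DistGt2 u≢v _  _  (zero , _ , here)                      = u≢v refl
  noCommonNeighbour⇒DistGt2 _   ¬a _  (suc zero , _ , step a here)           = ¬a a
  noCommonNeighbour⇒DistGt2 _   _  ¬c (suc (suc zero) , _ , step a (step b here)) = ¬c _ a b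
  noCommonNeighbour⇒DistGt2 _   _  _  (suc (suc (suc _)) , s≤s (s≤s ()) , _)

  packing-clash : {j : ℕ} {c : V X → Fin j} → IsPackingColoring X j c →
                  {u v : V X} {x : Fin j} {k : ℕ} → u ≢ v → c u ≡ x → c v ≡ x →
                  WalkWithin X u v k → k ≤ suc (toℕ x) → ⊥
  packing-clash pc {u} {v} u≢v refl cv (k , k≤ , w) k≤c = pc u v u≢v (sym cv) (k , ≤-trans k≤ k≤c , w)

  adjacent⇒colour≢ : {j : ℕ} {c : V X → Fin j} → IsPackingColoring X j c →
                     {u v : V X} → u ≢ v → Adj X u v → c u ≢ c v
  adjacent⇒colour≢ pc u≢v a cu≡cv = packing-clash pc u≢v refl (sym cu≡cv) (edge a) (s≤s z≤n)

record Path₄ (X : Graph) : Set where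
  field
    a b c d    : V X
    ab         : Adj X a b
    bc         : Adj X b c
    cd         : Adj X c d
    a≢b        : a ≢ b
    b≢c        : b ≢ c
    c≢d        : c ≢ d
    a≢c        : a ≢ c
    b≢d        : b ≢ d

module _ {X : Graph} (P : Path₄ X) where
  open Path₄ P

  -- With two colours the middle edge bc is coloured 1–2, and then the end next to the
  -- vertex of colour 1 must have colour 2 at distance 2 from the other vertex of colour 2.
  path₄⇒3≤colours : {j : ℕ} → HasPackingColoring X j → 3 ≤ j
  path₄⇒3≤colours {zero} (col , _) = ⊥-elim (¬Fin0 (col a))
  path₄⇒3≤colours {suc zero} (col , pc) with col a in ea | col b in eb
  ... | fzero | fzero = ⊥-elim (adjacent⇒colour≢ pc a≢b ab (trans ea (sym eb)))
  path₄⇒3≤colours {suc (suc zero)} (col , pc) with col b in eb | col c in ec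
  ... | fzero      | fzero      = ⊥-elim (adjacent⇒colour≢ pc b≢c bc (trans eb (sym ec)))
  ... | fsuc fzero | fsuc fzero = ⊥-elim (adjacent⇒colour≢ pc b≢c bc (trans eb (sym ec)))
  ... | fzero      | fsuc fzero with col a in ea
  ...   | fzero      = ⊥-elim (adjacent⇒colour≢ pc a≢b ab (trans ea (sym eb)))
  ...   | fsuc fzero = ⊥-elim (packing-clash pc a≢c ea ec (edge ab ⊙ edge bc) ≤-refl)
  path₄⇒3≤colours {suc (suc zero)} (col , pc) | fsuc fzero | fzero with col d in ed
  ...   | fzero      = ⊥-elim (adjacent⇒colour≢ pc c≢d cd (trans ec (sym ed)))
  ...   | fsuc fzero = ⊥-elim (packing-clash pc b≢d eb ed (edge bc ⊙ edge cd) ≤-refl)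
  path₄⇒3≤colours {suc (suc (suc _))} _ = s≤s (s≤s (s≤s z≤n))

-- A walk of length ≤ 2 between different copies crosses an edge (g , f g')(g' , f g)
-- at one of its ends, or two such edges through a common neighbour x in the copy x.
copies-far : {G H : Graph} (f : V G → V H) {g g' : V G} {h : V H} → g ≢ g' →
             (Adj G g g' → f g ≢ h × f g' ≢ h) → (∀ x → Adj G g x → Adj G x g' → f x ≢ h) →
             DistGt (Sierp G H f) (g , h) (g' , h) 2
copies-far {G} {H} f {g} {g'} {h} g≢g' adjacent common =
  noCommonNeighbour⇒DistGt2 (λ e → g≢g' (cong proj₁ e)) nonAdjacent noCommonNeighbour
  where
  nonAdjacent : ¬ SierpAdj G H f (g , h) (g' , h)
  nonAdjacent (inj₁ (g≡g' , _))    = g≢g' g≡g'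
  nonAdjacent (inj₂ (a , h≡ , _)) = proj₂ (adjacent a) (sym h≡)
  noCommonNeighbour : ∀ x → SierpAdj G H f (g , h) x → SierpAdj G H f x (g' , h) → ⊥
  noCommonNeighbour _ (inj₁ (refl , _)) (inj₁ (refl , _))   = g≢g' refl
  noCommonNeighbour _ (inj₁ (refl , _)) (inj₂ (a , _ , h≡)) = proj₁ (adjacent a) (sym h≡)
  noCommonNeighbour _ (inj₂ (a , h≡ , _)) (inj₁ (refl , _)) = proj₂ (adjacent a) (sym h≡)
  noCommonNeighbour (x , _) (inj₂ (a , h≡ , _)) (inj₂ (a' , _)) = common x a a' (sym h≡)

leaf≢centre : {k : ℕ} {a : Fin k} {x : Fin (suc k)} → fsuc a ≡ x → x ≢ fzero
leaf≢centre refl ()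

starCommonNeighbour : {m : ℕ} {g g' x : Fin (suc m)} → g ≢ g' → StarAdj g x → StarAdj x g' → x ≡ fzero
starCommonNeighbour {x = fzero}                       _    _ _ = refl
starCommonNeighbour {g = fzero} {fzero} {x = fsuc _} g≢g' _ _ = ⊥-elim (g≢g' refl)

starCopies-far : {m : ℕ} {H : Graph} (f : Fin (suc m) → V H) {g g' : Fin (suc m)} {h : V H} →
                 g ≢ g' → (StarAdj g g' → f g ≢ h × f g' ≢ h) → f fzero ≢ h →
                 DistGt (Sierp (Star m) H f) (g , h) (g' , h) 2
starCopies-far f g≢g' adjacent f₀≢h = copies-far f g≢g' adjacent λ x a a' →
  subst (λ y → f y ≢ _) (sym (starCommonNeighbour g≢g' a a')) f₀≢h

module _ {m n : ℕ} where

  neighbour : Fin (suc (suc n)) → Fin (suc (suc n))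
  neighbour fzero    = fsuc fzero
  neighbour (fsuc _) = fzero

  neighbour-adjˡ : ∀ h → StarAdj (neighbour h) h
  neighbour-adjˡ fzero    = tt
  neighbour-adjˡ (fsuc _) = tt

  neighbour-adjʳ : ∀ h → StarAdj h (neighbour h)
  neighbour-adjʳ fzero    = tt
  neighbour-adjʳ (fsuc _) = tt

  neighbour≢ : ∀ h → neighbour h ≢ h
  neighbour≢ fzero    ()
  neighbour≢ (fsuc _) ()

  path₄ : (f : Fin (suc (suc m)) → Fin (suc (suc n))) → Path₄ (Sierp (Star (suc m)) (Star (suc n)) f)
  path₄ f = record
    { a = fzero , neighbour (f one) ; b = fzero , f one
    ; c = one , f fzero             ; d = one , neighbour (f fzero)
    ; ab = inj₁ (refl , neighbour-adjˡ (f one))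
    ; bc = inj₂ (tt , refl , refl)
    ; cd = inj₁ (refl , neighbour-adjʳ (f fzero))
    ; a≢b = λ e → neighbour≢ (f one) (cong proj₂ e)
    ; b≢c = λ e → 0≢1+n (cong proj₁ e)
    ; c≢d = λ e → neighbour≢ (f fzero) (sym (cong proj₂ e))
    ; a≢c = λ e → 0≢1+n (cong proj₁ e)
    ; b≢d = λ e → 0≢1+n (cong proj₁ e)
    }
    where
    one : Fin (suc (suc m))
    one = fsuc fzero

  centreToLeaf : Fin (suc (suc m)) → Fin (suc (suc n))
  centreToLeaf fzero    = fsuc fzero
  centreToLeaf (fsuc _) = fzero

  colouring₃ : Fin (suc (suc m)) × Fin (suc (suc n)) → Fin 3
  colouring₃ (_      , fsuc _) = fzero
  colouring₃ (fsuc _ , fzero)  = fsuc fzero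
  colouring₃ (fzero  , fzero)  = fsuc (fsuc fzero)

  leaves-nonadjacent : ∀ {g g' h h'} →
    ¬ SierpAdj (Star (suc m)) (Star (suc n)) centreToLeaf (g , fsuc h) (g' , fsuc h')
  leaves-nonadjacent (inj₁ (_ , ()))
  leaves-nonadjacent {fzero}  {fsuc _} (inj₂ (_ , () , _))
  leaves-nonadjacent {fsuc _} {fzero}  (inj₂ (_ , _ , ()))

  colouring₃-isPacking : IsPackingColoring (Sierp (Star (suc m)) (Star (suc n)) centreToLeaf) 3 colouring₃
  colouring₃-isPacking (_ , fsuc _) (_ , fsuc _) u≢v _ = nonAdjacent⇒DistGt1 u≢v leaves-nonadjacent
  colouring₃-isPacking (fsuc _ , fzero) (fsuc _ , fzero) u≢v _ =
    starCopies-far centreToLeaf (λ e → u≢v (cong (_, fzero) e)) (λ ()) (λ ())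
  colouring₃-isPacking (fzero , fzero) (fzero , fzero) u≢v _ = ⊥-elim (u≢v refl)
  colouring₃-isPacking (_      , fsuc _) (fzero  , fzero)  _ ()
  colouring₃-isPacking (_      , fsuc _) (fsuc _ , fzero)  _ ()
  colouring₃-isPacking (fzero  , fzero)  (_      , fsuc _) _ ()
  colouring₃-isPacking (fsuc _ , fzero)  (_      , fsuc _) _ ()
  colouring₃-isPacking (fzero  , fzero)  (fsuc _ , fzero)  _ ()
  colouring₃-isPacking (fsuc _ , fzero)  (fzero  , fzero)  _ ()

  sierpinski-χ₃ : IsSierpinskiPackingChromaticNumber (Star (suc m)) (Star (suc n)) 3
  sierpinski-χ₃ = (centreToLeaf , (colouring₃ , colouring₃-isPacking) , λ _ → lowerBound centreToLeaf)
                , λ f _ → lowerBound f ∘ proj₁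
    where
    lowerBound : ∀ f {j} → HasPackingColoring (Sierp (Star (suc m)) (Star (suc n)) f) j → 3 ≤ j
    lowerBound f = path₄⇒3≤colours (path₄ f)

module _ {m n : ℕ} where

  -- The copy fsuc i owns the colour fsuc (fsuc i) and puts it on its hub: the leaf f 0 if the edge
  -- towards the copy 0 joins two leaves (which then cannot both get colour 1), otherwise its centre.
  -- The remaining centres get colour 2 and leaves colour 1.
  hub : (f₀ fᵢ : Fin (suc n)) → Fin (suc n)
  hub (fsuc a) (fsuc _) = fsuc a
  hub _        _        = fzero

  hub≢centre : ∀ f₀ fᵢ → hub f₀ fᵢ ≢ fzero → f₀ ≢ fzero × fᵢ ≢ fzero
  hub≢centre fzero    _        hub≢0 = ⊥-elim (hub≢0 refl)
  hub≢centre (fsuc _) fzero    hub≢0 = ⊥-elim (hub≢0 refl)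
  hub≢centre (fsuc _) (fsuc _) _     = (λ ()) , (λ ())

  hub-leaves : ∀ {f₀ fᵢ} → f₀ ≢ fzero → fᵢ ≢ fzero → hub f₀ fᵢ ≡ f₀
  hub-leaves {fzero}            f₀≢0 _    = ⊥-elim (f₀≢0 refl)
  hub-leaves {fsuc _} {fzero}   _    fᵢ≢0 = ⊥-elim (fᵢ≢0 refl)
  hub-leaves {fsuc _} {fsuc _}  _    _    = refl

  baseColour : Fin (suc n) → Fin (suc (suc m))
  baseColour fzero    = fsuc fzero
  baseColour (fsuc _) = fzero

  copyColour : Fin m → (x h : Fin (suc n)) → Fin (suc (suc m))
  copyColour i x h with h ≟ x
  ... | yes _ = fsuc (fsuc i)
  ... | no  _ = baseColour h

  copyColour-view : ∀ i x h → (h ≡ x × copyColour i x h ≡ fsuc (fsuc i))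
                            ⊎ (h ≢ x × copyColour i x h ≡ baseColour h)
  copyColour-view i x h with h ≟ x
  ... | yes h≡x = inj₁ (h≡x , refl)
  ... | no  h≢x = inj₂ (h≢x , refl)

  colour : (f : Fin (suc m) → Fin (suc n)) → Fin (suc m) × Fin (suc n) → Fin (suc (suc m))
  colour f (fzero  , h) = baseColour h
  colour f (fsuc i , h) = copyColour i (hub (f fzero) (f (fsuc i))) h

  module _ {f : Fin (suc m) → Fin (suc n)} where

    centre-colour≢1 : ∀ g → colour f (g , fzero) ≢ fzero
    centre-colour≢1 fzero ()
    centre-colour≢1 (fsuc i) with copyColour-view i (hub (f fzero) (f (fsuc i))) fzero
    ... | inj₁ (_ , c≡) = λ c≡1 → 0≢1+n (trans (sym c≡1) c≡)
    ... | inj₂ (_ , c≡) = λ c≡1 → 0≢1+n (trans (sym c≡1) c≡)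

    attachment-private : ∀ {i} → f fzero ≢ fzero → f (fsuc i) ≢ fzero →
                         colour f (fsuc i , f fzero) ≡ fsuc (fsuc i)
    attachment-private {i} f₀≢0 fᵢ≢0
      with copyColour-view i (hub (f fzero) (f (fsuc i))) (f fzero)
    ... | inj₁ (_ , c≡)   = c≡
    ... | inj₂ (f₀≢hub , _) = ⊥-elim (f₀≢hub (sym (hub-leaves f₀≢0 fᵢ≢0)))

    colour₁-independent : ∀ u v → colour f u ≡ fzero → colour f v ≡ fzero →
                          ¬ SierpAdj (Star m) (Star n) f u v
    colour₁-independent (g , fzero) _ cu _ _ = centre-colour≢1 g cu
    colour₁-independent (_ , fsuc _) (g' , fzero) _ cv _ = centre-colour≢1 g' cv
    colour₁-independent (_ , fsuc _) (_ , fsuc _) _ _ (inj₁ (_ , ()))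
    colour₁-independent (fzero , fsuc _) (fsuc i , fsuc _) _ cv (inj₂ (_ , fᵢ≡ , f₀≡)) =
      0≢1+n (trans (sym (subst (λ h → colour f (fsuc i , h) ≡ fzero) f₀≡ cv))
                   (attachment-private (leaf≢centre f₀≡) (leaf≢centre fᵢ≡)))
    colour₁-independent (fsuc i , fsuc _) (fzero , fsuc _) cu _ (inj₂ (_ , f₀≡ , fᵢ≡)) =
      0≢1+n (trans (sym (subst (λ h → colour f (fsuc i , h) ≡ fzero) f₀≡ cu))
                   (attachment-private (leaf≢centre f₀≡) (leaf≢centre fᵢ≡)))

    colour₂⇒freeCentre : ∀ g h → colour f (g , h) ≡ fsuc fzero →
                         h ≡ fzero × (g ≡ fzero ⊎ f fzero ≢ fzero × f g ≢ fzero)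
    colour₂⇒freeCentre fzero fzero    _  = refl , inj₁ refl
    colour₂⇒freeCentre fzero (fsuc _) ()
    colour₂⇒freeCentre (fsuc i) h c≡2 with copyColour-view i (hub (f fzero) (f (fsuc i))) h
    ... | inj₁ (_ , c≡) with () ← suc-injective (trans (sym c≡) c≡2)
    ... | inj₂ (h≢hub , c≡) with h | trans (sym c≡) c≡2
    ...   | fzero  | _  = refl , inj₂ (hub≢centre (f fzero) (f (fsuc i)) (h≢hub ∘ sym))
    ...   | fsuc _ | ()

    private⇒hub : ∀ g h {k} → colour f (g , h) ≡ fsuc (fsuc k) →
                  (g , h) ≡ (fsuc k , hub (f fzero) (f (fsuc k)))
    private⇒hub fzero fzero    ()
    private⇒hub fzero (fsuc _) ()
    private⇒hub (fsuc i) h c≡k with copyColour-view i (hub (f fzero) (f (fsuc i))) h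
    ... | inj₁ (refl , c≡) with refl ← suc-injective (suc-injective (trans (sym c≡) c≡k)) = refl
    ... | inj₂ (_ , c≡) with h | trans (sym c≡) c≡k
    ...   | fzero  | ()
    ...   | fsuc _ | ()

    freeCentres-far : ∀ {g g'} → g ≢ g' →
                      g  ≡ fzero ⊎ f fzero ≢ fzero × f g  ≢ fzero →
                      g' ≡ fzero ⊎ f fzero ≢ fzero × f g' ≢ fzero →
                      DistGt (Sierp (Star m) (Star n) f) (g , fzero) (g' , fzero) 2
    freeCentres-far g≢g' (inj₁ refl) (inj₁ refl) = ⊥-elim (g≢g' refl)
    freeCentres-far g≢g' (inj₁ refl) (inj₂ (f₀≢0 , f'≢0)) = starCopies-far f g≢g' (λ _ → f₀≢0 , f'≢0) f₀≢0
    freeCentres-far g≢g' (inj₂ (f₀≢0 , f≢0)) (inj₁ refl) = starCopies-far f g≢g' (λ _ → f≢0 , f₀≢0) f₀≢0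
    freeCentres-far g≢g' (inj₂ (f₀≢0 , f≢0)) (inj₂ (_ , f'≢0)) = starCopies-far f g≢g' (λ _ → f≢0 , f'≢0) f₀≢0

    colour-isPacking : IsPackingColoring (Sierp (Star m) (Star n) f) (2 + m) (colour f)
    colour-isPacking (g , h) (g' , h') u≢v same with colour f (g , h) in cu
    ... | fzero = nonAdjacent⇒DistGt1 u≢v (colour₁-independent (g , h) (g' , h') cu (sym same))
    ... | fsuc fzero with colour₂⇒freeCentre g h cu | colour₂⇒freeCentre g' h' (sym same)
    ...   | refl , free | refl , free' = freeCentres-far (λ e → u≢v (cong (_, fzero) e)) free free'
    colour-isPacking (g , h) (g' , h') u≢v same | fsuc (fsuc k) =
      ⊥-elim (u≢v (trans (private⇒hub g h cu) (sym (private⇒hub g' h' (sym same)))))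

some-colour≥4 : {j : ℕ} (x y z : Fin (suc j)) → x ≢ fzero → y ≢ fzero → z ≢ fzero →
                x ≢ y → x ≢ z → y ≢ z → 3 ≤ toℕ x ⊎ 3 ≤ toℕ y ⊎ 3 ≤ toℕ z
some-colour≥4 (fsuc (fsuc (fsuc _))) _ _ _ _ _ _ _ _ = inj₁ (s≤s (s≤s (s≤s z≤n)))
some-colour≥4 _ (fsuc (fsuc (fsuc _))) _ _ _ _ _ _ _ = inj₂ (inj₁ (s≤s (s≤s (s≤s z≤n))))
some-colour≥4 _ _ (fsuc (fsuc (fsuc _))) _ _ _ _ _ _ = inj₂ (inj₂ (s≤s (s≤s (s≤s z≤n))))
some-colour≥4 fzero _ _ x≢0 _ _ _ _ _ = ⊥-elim (x≢0 refl)
some-colour≥4 _ fzero _ _ y≢0 _ _ _ _ = ⊥-elim (y≢0 refl)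
some-colour≥4 _ _ fzero _ _ z≢0 _ _ _ = ⊥-elim (z≢0 refl)
some-colour≥4 (fsuc fzero)        (fsuc fzero)        _ _ _ _ x≢y _ _ = ⊥-elim (x≢y refl)
some-colour≥4 (fsuc (fsuc fzero)) (fsuc (fsuc fzero)) _ _ _ _ x≢y _ _ = ⊥-elim (x≢y refl)
some-colour≥4 (fsuc fzero)        _ (fsuc fzero)        _ _ _ _ x≢z _ = ⊥-elim (x≢z refl)
some-colour≥4 (fsuc (fsuc fzero)) _ (fsuc (fsuc fzero)) _ _ _ _ x≢z _ = ⊥-elim (x≢z refl)
some-colour≥4 _ (fsuc fzero)        (fsuc fzero)        _ _ _ _ _ y≢z = ⊥-elim (y≢z refl)
some-colour≥4 _ (fsuc (fsuc fzero)) (fsuc (fsuc fzero)) _ _ _ _ _ y≢z = ⊥-elim (y≢z refl)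

2≤colour : {j : ℕ} {x : Fin (suc j)} → x ≢ fzero → 2 ≤ suc (toℕ x)
2≤colour {x = fzero}  x≢0 = ⊥-elim (x≢0 refl)
2≤colour {x = fsuc _} _   = s≤s (s≤s z≤n)

module _ {m n : ℕ} where

  atCentre : Fin (suc m) → Fin (suc (3 + n))
  atCentre _ = fzero

  AtCentre : Graph
  AtCentre = Sierp (Star m) (Star (3 + n)) atCentre

  toCentre : ∀ g h → WalkWithin AtCentre (g , h) (g , fzero) 1
  toCentre g fzero    = stay
  toCentre g (fsuc _) = edge (inj₁ (refl , tt))

  fromCentre : ∀ g h → WalkWithin AtCentre (g , fzero) (g , h) 1
  fromCentre g fzero    = stay
  fromCentre g (fsuc _) = edge (inj₁ (refl , tt))

  toRoot : ∀ g → WalkWithin AtCentre (g , fzero) (fzero , fzero) 1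
  toRoot fzero    = stay
  toRoot (fsuc _) = edge (inj₂ (tt , refl , refl))

  fromRoot : ∀ g → WalkWithin AtCentre (fzero , fzero) (g , fzero) 1
  fromRoot fzero    = stay
  fromRoot (fsuc _) = edge (inj₂ (tt , refl , refl))

  centres-close : ∀ g g' → WalkWithin AtCentre (g , fzero) (g' , fzero) 2
  centres-close g g' = toRoot g ⊙ fromRoot g'

  diameter≤4 : ∀ u v → WalkWithin AtCentre u v 4
  diameter≤4 (g , h) (g' , h') = toCentre g h ⊙ (centres-close g g' ⊙ fromCentre g' h')

  module _ {j : ℕ} {col : V AtCentre → Fin (suc j)} (pc : IsPackingColoring AtCentre (suc j) col) where

    -- A vertex whose colour no other centre, or no other vertex at all, may share.
    Distinguished : V AtCentre → Set
    Distinguished (g , h) = (h ≡ fzero × col (g , h) ≢ fzero) ⊎ 3 ≤ toℕ (col (g , h))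

    leaf-colour≢1 : ∀ g h → col (g , fzero) ≡ fzero → col (g , fsuc h) ≢ fzero
    leaf-colour≢1 g h c₀≡1 c≡1 =
      adjacent⇒colour≢ pc (λ ()) (inj₁ (refl , tt)) (trans c₀≡1 (sym c≡1))

    leaf-colours-differ : ∀ g {h h'} → h ≢ h' → col (g , fzero) ≡ fzero →
                          col (g , fsuc h) ≢ col (g , fsuc h')
    leaf-colours-differ g {h} {h'} h≢h' c₀≡1 same =
      packing-clash pc (λ e → h≢h' (suc-injective (cong proj₂ e))) refl (sym same)
        (toCentre g (fsuc h) ⊙ fromCentre g (fsuc h'))
        (2≤colour (leaf-colour≢1 g h c₀≡1))

    distinguished : ∀ g → Σ (Fin (suc (3 + n))) λ h → Distinguished (g , h)
    distinguished g with col (g , fzero) in c₀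
    ... | fsuc _ = fzero , inj₁ (refl , λ c≡1 → 0≢1+n (trans (sym c≡1) c₀))
    ... | fzero
      with some-colour≥4 (col (g , fsuc fzero)) (col (g , fsuc (fsuc fzero)))
                         (col (g , fsuc (fsuc (fsuc fzero))))
             (leaf-colour≢1 g _ c₀) (leaf-colour≢1 g _ c₀) (leaf-colour≢1 g _ c₀)
             (leaf-colours-differ g (λ ()) c₀) (leaf-colours-differ g (λ ()) c₀)
             (leaf-colours-differ g (λ ()) c₀)
    ...   | inj₁ big        = _ , inj₂ big
    ...   | inj₂ (inj₁ big) = _ , inj₂ big
    ...   | inj₂ (inj₂ big) = _ , inj₂ big

    distinguished-colours-differ : ∀ {u v} → proj₁ u ≢ proj₁ v → Distinguished u → Distinguished v →
                                   col u ≢ col v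
    distinguished-colours-differ {u} {v} g≢g' (inj₂ big) _ same =
      packing-clash pc (λ e → g≢g' (cong proj₁ e)) refl (sym same) (diameter≤4 u v) (s≤s big)
    distinguished-colours-differ {u} {v} g≢g' (inj₁ _) (inj₂ big) same =
      packing-clash pc (λ e → g≢g' (sym (cong proj₁ e))) refl same (diameter≤4 v u) (s≤s big)
    distinguished-colours-differ {g , _} {g' , _} g≢g' (inj₁ (refl , c≢1)) (inj₁ (refl , _)) same =
      packing-clash pc (λ e → g≢g' (cong proj₁ e)) refl (sym same) (centres-close g g') (2≤colour c≢1)

    distinguished-colour≢1 : ∀ {u} → Distinguished u → col u ≢ fzero
    distinguished-colour≢1 (inj₁ (_ , c≢1)) = c≢1
    distinguished-colour≢1 (inj₂ big) c≡1 with () ← subst (λ x → 3 ≤ toℕ x) c≡1 big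

    witness : ∀ g → Distinguished (g , proj₁ (distinguished g))
    witness g = proj₂ (distinguished g)

    usedColour : Fin (suc (suc m)) → Fin (suc j)
    usedColour fzero    = fzero
    usedColour (fsuc g) = col (g , proj₁ (distinguished g))

    usedColour-injective : Injective _≡_ _≡_ usedColour
    usedColour-injective {fzero}  {fzero}   _ = refl
    usedColour-injective {fzero}  {fsuc g'} e = ⊥-elim (distinguished-colour≢1 (witness g') (sym e))
    usedColour-injective {fsuc g} {fzero}   e = ⊥-elim (distinguished-colour≢1 (witness g) e)
    usedColour-injective {fsuc g} {fsuc g'} e with g ≟ g'
    ... | yes refl = refl
    ... | no g≢g'  = ⊥-elim (distinguished-colours-differ g≢g' (witness g) (witness g') e)

  atCentre⇒2+m≤colours : ∀ {j} → HasPackingColoring AtCentre j → 2 + m ≤ j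
  atCentre⇒2+m≤colours {zero}  (col , _)  = ⊥-elim (¬Fin0 (col (fzero , fzero)))
  atCentre⇒2+m≤colours {suc j} (col , pc) = injective⇒≤ (usedColour-injective pc)

upperSierpinski : ∀ {m n} → IsUpperSierpinskiPackingChromaticNumber (Star m) (Star (3 + n)) (2 + m)
upperSierpinski {m} =
    (atCentre , (colour atCentre , colour-isPacking) , λ _ → atCentre⇒2+m≤colours)
  , λ f _ χ≡ → proj₂ χ≡ (2 + m) (colour f , colour-isPacking)

theorem4p7 : (m n : ℕ) → 3 ≤ m → 3 ≤ n →
    IsSierpinskiPackingChromaticNumber (Star m) (Star n) 3
    × Σ ℕ (λ k → IsUpperSierpinskiPackingChromaticNumber (Star m) (Star n) k
                 × ((m + 2) ⊓ (n + 2) ≤ k) × (k ≤ (m + 2) ⊔ (n + 2)))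
theorem4p7 m n (s≤s _) (s≤s (s≤s (s≤s _))) =
  sierpinski-χ₃ , 2 + m , upperSierpinski ,
  ≤-trans (m⊓n≤m (m + 2) (n + 2)) (≤-reflexive (+-comm m 2)) ,
  ≤-trans (≤-reflexive (+-comm 2 m)) (m≤m⊔n (m + 2) (n + 2))
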